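{- Let $f:\{0,1\}^n\to\{0,1\}$ be a non-constant Boolean function and $x\in\{0,1\}^n$ with $f(x)=b\in\{0,1\}$. Then $$P_0^{(\partial f(x;\cdot))}=\{p_b+x:\ p_b\in P_b^{(f)}|_x\}.$$
   Context: Values $\{0,u,1\}$ ($0,1$ stable). Order $\preceq$: $u\preceq0$, $u\preceq1$, $0,1$ incomparable, coordinatewise. For $x\in\{0,u,1\}^n$, $R(x)=\{y\in\{0,1\}^n: x\preceq y\}$; for Boolean $h$, $\tilde h(x)=c$ if $h\equiv c$ on $R(x)$ ($c\in\{0,1\}$), else $u$. Prime implicants $P_1^{(h)}$: $p$ with $\tilde h(p)=1$ such that replacing any stable coordinate by $u$ gives $\tilde h=u$; prime implicates $P_0^{(h)}$ analogously with value $0$. $P_b^{(f)}|_x=\{p\in P_b^{(f)}: p\preceq x\}$. Ternary XOR: for $s,t\in\{0,u,1\}$, $s+t=0$ if $s=t\ne u$, $1$ if $s\neq t$ and both stable, and $u$ if either is $u$; applied coordinatewise. Hazard-derivative: for $x,y\in\{0,1\}^n$, $x+uy$ has coordinate $x_i$ if $y_i=0$ and $u$ if $y_i=1$; $\partial f(x;y)=0$ if $\tilde f(x+uy)=f(x)$, $1$ if $=u$; $\partial f(x;\cdot)$ is a Boolean function of $y$. -}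

module Defs where

open import Data.Bool using (Bool; true; false; not; _∧_)
open import Data.Nat using (ℕ; zero; suc)
open import Data.Fin using (Fin; zero; suc)
open import Data.Vec using (Vec; []; _∷_; zipWith; lookup; _[_]≔_; map)
open import Data.List using (List; []; _∷_; _++_) renaming (map to lmap)
open import Data.Product using (_×_; ∃; ∃-syntax; _,_)
open import Relation.Binary.PropositionalEquality using (_≡_; _≢_)
open import Relation.Nullary using (¬_)

data T : Set where
  𝟎 𝐮 𝟏 : T

⌜_⌝ : Bool → T
⌜ false ⌝ = 𝟎
⌜ true ⌝ = 𝟏

⌜_⌝ᵛ : ∀ {n} → Vec Bool n → Vec T n
⌜ v ⌝ᵛ = map ⌜_⌝ v

data _⪯ₜ_ : T → T → Set where
  refl⪯ : ∀ {s} → s ⪯ₜ s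
  u⪯ : ∀ {s} → 𝐮 ⪯ₜ s

data _⪯_ : ∀ {n} → Vec T n → Vec T n → Set where
  []⪯ : [] ⪯ []
  _∷⪯_ : ∀ {n s t} {xs ys : Vec T n} → s ⪯ₜ t → xs ⪯ ys → (s ∷ xs) ⪯ (t ∷ ys)

-- R(x) as an explicit list of all Boolean resolutions of x
resolutions : ∀ {n} → Vec T n → List (Vec Bool n)
resolutions [] = [] ∷ []
resolutions (𝟎 ∷ xs) = lmap (false ∷_) (resolutions xs)
resolutions (𝟏 ∷ xs) = lmap (true ∷_) (resolutions xs)
resolutions (𝐮 ∷ xs) = lmap (false ∷_) (resolutions xs) ++ lmap (true ∷_) (resolutions xs)

allᵇ : ∀ {A : Set} → (A → Bool) → List A → Bool
allᵇ P [] = true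
allᵇ P (a ∷ as) = P a ∧ allᵇ P as

_==_ : Bool → Bool → Bool
false == false = true
true == true = true
_ == _ = false

tilde : ∀ {n} → (Vec Bool n → Bool) → Vec T n → T
tilde h x with allᵇ (λ y → h y == true) (resolutions x) | allᵇ (λ y → h y == false) (resolutions x)
... | true  | _     = 𝟏
... | false | true  = 𝟎
... | false | false = 𝐮

Stable : T → Set
Stable s = s ≢ 𝐮

-- prime implicants (b = true) / prime implicates (b = false) of h
Prime : ∀ {n} → (Vec Bool n → Bool) → Bool → Vec T n → Set
Prime {n} h b p =
  tilde h p ≡ ⌜ b ⌝ ×
  ((i : Fin n) → Stable (lookup p i) → tilde h (p [ i ]≔ 𝐮) ≡ 𝐮)

_⊕_ : T → T → T
𝐮 ⊕ _ = 𝐮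
_ ⊕ 𝐮 = 𝐮
𝟎 ⊕ 𝟎 = 𝟎
𝟏 ⊕ 𝟏 = 𝟎
𝟎 ⊕ 𝟏 = 𝟏
𝟏 ⊕ 𝟎 = 𝟏

_⊕ᵛ_ : ∀ {n} → Vec T n → Vec T n → Vec T n
_⊕ᵛ_ = zipWith _⊕_

_+u_ : ∀ {n} → Vec Bool n → Vec Bool n → Vec T n
x +u y = zipWith (λ xi yi → if' yi xi) x y
  where
  if' : Bool → Bool → T
  if' true _ = 𝐮
  if' false xi = ⌜ xi ⌝

_=ₜ_ : T → T → Bool
𝟎 =ₜ 𝟎 = true
𝐮 =ₜ 𝐮 = true
𝟏 =ₜ 𝟏 = true
_ =ₜ _ = false

-- hazard derivative ∂f(x; y): 0 if f̃(x+uy) = f(x), 1 otherwise (then it is u)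
∂ : ∀ {n} → (Vec Bool n → Bool) → Vec Bool n → Vec Bool n → Bool
∂ f x y = not (tilde f (x +u y) =ₜ ⌜ f x ⌝)

NonConstant : ∀ {n} → (Vec Bool n → Bool) → Set
NonConstant f = ∃[ y ] ∃[ z ] (f y ≢ f z)

{-# OPTIONS --safe #-}
module Submission where

-- Write g = ∂f(x;·). For Boolean y, g(y) = 0 iff f ≡ f(x) on R(x +u y), and R(x +u y) grows with y;
-- so g ≡ 0 on R(q) iff f ≡ f(x) on R(x +u supp q), where supp q resolves every 𝐮 of q to 1.
-- A prime implicate q of g has no 1 entries, since turning a 1 into 𝐮 does not change supp q.
-- On {0,𝐮}ⁿ we have x +u supp q = q + x, and q ↦ q + x is an involution onto {p : p ⪯ x}
-- that preserves stable coordinates and commutes with setting a coordinate to 𝐮. The two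
-- primality conditions then match coordinatewise: g cannot be constantly 1 on R(q) because
-- 0ⁿ ∈ R(q) and g(0ⁿ) = 0, and f cannot be constantly ¬f(x) on R(p) because x ∈ R(p).

open import Defs
open import Data.Nat using (ℕ)
open import Data.Bool using (Bool; true; false; not; _∧_)
open import Data.Bool.Properties using (∧-conicalˡ; ∧-conicalʳ; T-≡)
open import Data.Fin using (Fin; zero; suc)
open import Data.Vec using (Vec; []; _∷_; lookup; _[_]≔_; replicate; map)
open import Data.Vec.Properties using (map-[]≔; []≔-lookup; lookup-map)
open import Data.List using (List; []; _∷_) renaming (map to lmap)
open import Data.List.Membership.Propositional using (_∈_)
open import Data.List.Membership.Propositional.Properties using (∈-map⁺; ∈-map⁻; ∈-++⁺ˡ; ∈-++⁺ʳ; ∈-++⁻)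
open import Data.List.Relation.Unary.Any using (here; there)
open import Data.Product using (_×_; ∃-syntax; _,_)
open import Data.Sum using (inj₁; inj₂)
open import Data.Empty using (⊥-elim)
open import Function using (_∘_)
open import Function.Bundles using (_⇔_; mk⇔; Equivalence)
open Equivalence using (to; from)
open import Function.Properties.Equivalence using () renaming (sym to ⇔-sym; trans to ⇔-trans)
open import Function.Related.TypeIsomorphisms using (¬-cong-⇔)
open import Relation.Nullary using (¬_)
open import Relation.Nullary.Reflects using (Reflects; ofʸ; ofⁿ; fromEquivalence)
open import Relation.Binary.PropositionalEquality using (_≡_; _≢_; refl; sym; trans; cong; cong₂; subst; module ≡-Reasoning)

private variable
  n : ℕ

==-≡true⇔ : ∀ a c → (a == c) ≡ true ⇔ a ≡ c
==-≡true⇔ false false = mk⇔ (λ _ → refl) (λ _ → refl)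
==-≡true⇔ true  true  = mk⇔ (λ _ → refl) (λ _ → refl)
==-≡true⇔ false true  = mk⇔ (λ ()) (λ ())
==-≡true⇔ true  false = mk⇔ (λ ()) (λ ())

not-=ₜ⌜⌝≡false⇔ : ∀ t c → not (t =ₜ ⌜ c ⌝) ≡ false ⇔ t ≡ ⌜ c ⌝
not-=ₜ⌜⌝≡false⇔ 𝟎 false = mk⇔ (λ _ → refl) (λ _ → refl)
not-=ₜ⌜⌝≡false⇔ 𝟏 true  = mk⇔ (λ _ → refl) (λ _ → refl)
not-=ₜ⌜⌝≡false⇔ 𝟎 true  = mk⇔ (λ ()) (λ ())
not-=ₜ⌜⌝≡false⇔ 𝟏 false = mk⇔ (λ ()) (λ ())
not-=ₜ⌜⌝≡false⇔ 𝐮 false = mk⇔ (λ ()) (λ ())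
not-=ₜ⌜⌝≡false⇔ 𝐮 true  = mk⇔ (λ ()) (λ ())

allᵇ-≡true⇔ : ∀ {A : Set} (P : A → Bool) (l : List A) →
  allᵇ P l ≡ true ⇔ (∀ {a} → a ∈ l → P a ≡ true)
allᵇ-≡true⇔ P [] = mk⇔ (λ _ ()) (λ _ → refl)
allᵇ-≡true⇔ P (a ∷ l) = mk⇔ ⇒ ⇐
  where
  ⇒ : P a ∧ allᵇ P l ≡ true → ∀ {b} → b ∈ a ∷ l → P b ≡ true
  ⇒ e (here refl) = ∧-conicalˡ _ _ e
  ⇒ e (there b∈l) = to (allᵇ-≡true⇔ P l) (∧-conicalʳ _ _ e) b∈l
  ⇐ : (∀ {b} → b ∈ a ∷ l → P b ≡ true) → P a ∧ allᵇ P l ≡ true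
  ⇐ h rewrite h (here refl) = from (allᵇ-≡true⇔ P l) (h ∘ there)

∈-resolutions⇔ : {x : Vec T n} {y : Vec Bool n} → y ∈ resolutions x ⇔ x ⪯ ⌜ y ⌝ᵛ
∈-resolutions⇔ = mk⇔ ⇒ ⇐
  where
  ⇒ : {x : Vec T n} {y : Vec Bool n} → y ∈ resolutions x → x ⪯ ⌜ y ⌝ᵛ
  ⇒ {x = []} {[]} _ = []⪯
  ⇒ {x = 𝟎 ∷ x} y∈ with _ , z∈ , refl ← ∈-map⁻ (false ∷_) y∈ = refl⪯ ∷⪯ ⇒ z∈
  ⇒ {x = 𝟏 ∷ x} y∈ with _ , z∈ , refl ← ∈-map⁻ (true ∷_) y∈ = refl⪯ ∷⪯ ⇒ z∈
  ⇒ {x = 𝐮 ∷ x} y∈ with ∈-++⁻ (lmap (false ∷_) (resolutions x)) y∈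
  ... | inj₁ y∈₀ with _ , z∈ , refl ← ∈-map⁻ (false ∷_) y∈₀ = u⪯ ∷⪯ ⇒ z∈
  ... | inj₂ y∈₁ with _ , z∈ , refl ← ∈-map⁻ (true ∷_) y∈₁ = u⪯ ∷⪯ ⇒ z∈
  ⇐ : {x : Vec T n} {y : Vec Bool n} → x ⪯ ⌜ y ⌝ᵛ → y ∈ resolutions x
  ⇐ {x = []} {[]} []⪯ = here refl
  ⇐ {x = 𝟎 ∷ x} {false ∷ y} (_ ∷⪯ r) = ∈-map⁺ (false ∷_) (⇐ r)
  ⇐ {x = 𝟏 ∷ x} {true ∷ y} (_ ∷⪯ r) = ∈-map⁺ (true ∷_) (⇐ r)
  ⇐ {x = 𝐮 ∷ x} {false ∷ y} (_ ∷⪯ r) = ∈-++⁺ˡ (∈-map⁺ (false ∷_) (⇐ r))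
  ⇐ {x = 𝐮 ∷ x} {true ∷ y} (_ ∷⪯ r) = ∈-++⁺ʳ (lmap (false ∷_) (resolutions x)) (∈-map⁺ (true ∷_) (⇐ r))
  ⇐ {x = 𝟎 ∷ x} {true ∷ y} (() ∷⪯ _)
  ⇐ {x = 𝟏 ∷ x} {false ∷ y} (() ∷⪯ _)

Const : (Vec Bool n → Bool) → Vec T n → Bool → Set
Const h x c = ∀ y → x ⪯ ⌜ y ⌝ᵛ → h y ≡ c

allᵇ-resolutions-≡true⇔Const : ∀ (h : Vec Bool n → Bool) x c →
  allᵇ (λ y → h y == c) (resolutions x) ≡ true ⇔ Const h x c
allᵇ-resolutions-≡true⇔Const h x c = mk⇔
  (λ e y r → to (==-≡true⇔ (h y) c) (to (allᵇ-≡true⇔ _ _) e (from ∈-resolutions⇔ r)))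
  (λ k → from (allᵇ-≡true⇔ _ _) λ y∈ → from (==-≡true⇔ _ c) (k _ (to ∈-resolutions⇔ y∈)))

Const-reflects : ∀ (h : Vec Bool n → Bool) x c →
  Reflects (Const h x c) (allᵇ (λ y → h y == c) (resolutions x))
Const-reflects h x c = fromEquivalence (to E ∘ to T-≡) (from T-≡ ∘ from E)
  where E = allᵇ-resolutions-≡true⇔Const h x c

nonzero : T → Bool
nonzero 𝟎 = false
nonzero _ = true

-- The largest point of R(q): every 𝐮 is resolved to true.
supp : Vec T n → Vec Bool n
supp = map nonzero

⪯-supp : (q : Vec T n) → q ⪯ ⌜ supp q ⌝ᵛ
⪯-supp [] = []⪯
⪯-supp (𝟎 ∷ q) = refl⪯ ∷⪯ ⪯-supp q
⪯-supp (𝐮 ∷ q) = u⪯ ∷⪯ ⪯-supp q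
⪯-supp (𝟏 ∷ q) = refl⪯ ∷⪯ ⪯-supp q

Const-unique : ∀ {h : Vec Bool n → Bool} {x c d} → Const h x c → Const h x d → c ≡ d
Const-unique {x = x} k k′ = trans (sym (k _ (⪯-supp x))) (k′ _ (⪯-supp x))

data TildeView (h : Vec Bool n → Bool) (x : Vec T n) : T → Set where
  constant : ∀ c → Const h x c → TildeView h x ⌜ c ⌝
  varying  : (∀ c → ¬ Const h x c) → TildeView h x 𝐮

tilde-view : ∀ (h : Vec Bool n → Bool) x → TildeView h x (tilde h x)
tilde-view h x
  with allᵇ (λ y → h y == true) (resolutions x) | Const-reflects h x true
     | allᵇ (λ y → h y == false) (resolutions x) | Const-reflects h x false
... | true  | ofʸ k₁  | _     | _       = constant true k₁
... | false | ofⁿ _   | true  | ofʸ k₀  = constant false k₀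
... | false | ofⁿ ¬k₁ | false | ofⁿ ¬k₀ = varying λ { false → ¬k₀ ; true → ¬k₁ }

⌜⌝-injective : ∀ {a c} → ⌜ a ⌝ ≡ ⌜ c ⌝ → a ≡ c
⌜⌝-injective {false} {false} _ = refl
⌜⌝-injective {true}  {true}  _ = refl

⌜⌝≢𝐮 : ∀ c → ⌜ c ⌝ ≢ 𝐮
⌜⌝≢𝐮 false ()
⌜⌝≢𝐮 true ()

tilde≡⌜⌝⇔Const : ∀ (h : Vec Bool n → Bool) x c → tilde h x ≡ ⌜ c ⌝ ⇔ Const h x c
tilde≡⌜⌝⇔Const h x c with tilde h x | tilde-view h x
... | _ | constant d k = mk⇔ (λ e → subst (Const h x) (⌜⌝-injective e) k) (cong ⌜_⌝ ∘ Const-unique k)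
... | _ | varying ¬k   = mk⇔ (λ e → ⊥-elim (⌜⌝≢𝐮 c (sym e))) (⊥-elim ∘ ¬k c)

tilde≡𝐮⇔Varying : ∀ (h : Vec Bool n → Bool) x → tilde h x ≡ 𝐮 ⇔ (∀ c → ¬ Const h x c)
tilde≡𝐮⇔Varying h x with tilde h x | tilde-view h x
... | _ | constant d k = mk⇔ (⊥-elim ∘ ⌜⌝≢𝐮 d) (λ ¬k → ⊥-elim (¬k d k))
... | _ | varying ¬k   = mk⇔ (λ _ → ¬k) (λ _ → refl)

-- A point z of R(v) rules out every constant value other than h z.
tilde≡𝐮⇔¬Const : ∀ {h : Vec Bool n → Bool} {v z c} → v ⪯ ⌜ z ⌝ᵛ → h z ≡ c →
  tilde h v ≡ 𝐮 ⇔ (¬ Const h v c)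
tilde≡𝐮⇔¬Const {h = h} {v} {z} {c} r hz≡c = mk⇔
  (λ e → to (tilde≡𝐮⇔Varying h v) e c)
  (λ ¬k → from (tilde≡𝐮⇔Varying h v) λ d k → ¬k (subst (Const h v) (trans (sym (k z r)) hz≡c) k))

⪯ₜ-trans : ∀ {s t w} → s ⪯ₜ t → t ⪯ₜ w → s ⪯ₜ w
⪯ₜ-trans refl⪯ t⪯w = t⪯w
⪯ₜ-trans u⪯    _   = u⪯

⪯-trans : {u v w : Vec T n} → u ⪯ v → v ⪯ w → u ⪯ w
⪯-trans []⪯ []⪯ = []⪯
⪯-trans (s ∷⪯ u⪯v) (t ∷⪯ v⪯w) = ⪯ₜ-trans s t ∷⪯ ⪯-trans u⪯v v⪯w

[]≔𝐮-⪯ : {q v : Vec T n} (i : Fin n) → q ⪯ v → (q [ i ]≔ 𝐮) ⪯ v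
[]≔𝐮-⪯ zero    (_ ∷⪯ r) = u⪯ ∷⪯ r
[]≔𝐮-⪯ (suc i) (s ∷⪯ r) = s ∷⪯ []≔𝐮-⪯ i r

Const-anti : ∀ {h : Vec Bool n → Bool} {v w c} → v ⪯ w → Const h v c → Const h w c
Const-anti v⪯w k y w⪯y = k y (⪯-trans v⪯w w⪯y)

⌜⌝ᵛ-⪯⇒≡ : {x z : Vec Bool n} → ⌜ x ⌝ᵛ ⪯ ⌜ z ⌝ᵛ → x ≡ z
⌜⌝ᵛ-⪯⇒≡ {x = []} {[]} []⪯ = refl
⌜⌝ᵛ-⪯⇒≡ {x = false ∷ x} {false ∷ z} (_ ∷⪯ r) = cong (false ∷_) (⌜⌝ᵛ-⪯⇒≡ r)
⌜⌝ᵛ-⪯⇒≡ {x = true ∷ x}  {true ∷ z}  (_ ∷⪯ r) = cong (true ∷_) (⌜⌝ᵛ-⪯⇒≡ r)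
⌜⌝ᵛ-⪯⇒≡ {x = false ∷ x} {true ∷ z}  (() ∷⪯ _)
⌜⌝ᵛ-⪯⇒≡ {x = true ∷ x}  {false ∷ z} (() ∷⪯ _)

Const-⌜⌝ᵛ : ∀ (h : Vec Bool n → Bool) x → Const h ⌜ x ⌝ᵛ (h x)
Const-⌜⌝ᵛ h x z r = cong h (sym (⌜⌝ᵛ-⪯⇒≡ r))

-- q ⪯ ⌜ falses ⌝ᵛ encodes q ∈ {𝟎,𝐮}ⁿ.
falses : Vec Bool n
falses = replicate _ false

+u-falses : (x : Vec Bool n) → x +u falses ≡ ⌜ x ⌝ᵛ
+u-falses [] = refl
+u-falses (a ∷ x) = cong (⌜ a ⌝ ∷_) (+u-falses x)

+u-⪯ : (x y : Vec Bool n) → (x +u y) ⪯ ⌜ x ⌝ᵛ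
+u-⪯ [] [] = []⪯
+u-⪯ (a ∷ x) (false ∷ y) = refl⪯ ∷⪯ +u-⪯ x y
+u-⪯ (a ∷ x) (true ∷ y)  = u⪯ ∷⪯ +u-⪯ x y

+u-supp-⪯ : (x y : Vec Bool n) (q : Vec T n) → q ⪯ ⌜ y ⌝ᵛ → (x +u supp q) ⪯ (x +u y)
+u-supp-⪯ [] [] [] []⪯ = []⪯
+u-supp-⪯ (a ∷ x) (false ∷ y) (𝟎 ∷ q) (_ ∷⪯ r) = refl⪯ ∷⪯ +u-supp-⪯ x y q r
+u-supp-⪯ (a ∷ x) (true ∷ y)  (𝟎 ∷ q) (() ∷⪯ _)
+u-supp-⪯ (a ∷ x) (b ∷ y)     (𝐮 ∷ q) (_ ∷⪯ r) = u⪯ ∷⪯ +u-supp-⪯ x y q r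
+u-supp-⪯ (a ∷ x) (b ∷ y)     (𝟏 ∷ q) (_ ∷⪯ r) = u⪯ ∷⪯ +u-supp-⪯ x y q r

supp-[]≔𝐮 : (q : Vec T n) (i : Fin n) → lookup q i ≡ 𝟏 → supp (q [ i ]≔ 𝐮) ≡ supp q
supp-[]≔𝐮 q i qᵢ≡𝟏 = begin
  supp (q [ i ]≔ 𝐮)               ≡⟨ map-[]≔ _ q i ⟩
  supp q [ i ]≔ true              ≡⟨ cong (supp q [ i ]≔_) supp-qᵢ ⟨
  supp q [ i ]≔ lookup (supp q) i ≡⟨ []≔-lookup (supp q) i ⟩
  supp q                          ∎
  where
  open ≡-Reasoning
  supp-qᵢ : lookup (supp q) i ≡ true
  supp-qᵢ = trans (lookup-map i nonzero q) (cong nonzero qᵢ≡𝟏)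

⊕-involutive : ∀ t c → (t ⊕ ⌜ c ⌝) ⊕ ⌜ c ⌝ ≡ t
⊕-involutive 𝟎 false = refl
⊕-involutive 𝟎 true  = refl
⊕-involutive 𝐮 _     = refl
⊕-involutive 𝟏 false = refl
⊕-involutive 𝟏 true  = refl

⊕ᵛ-involutive : (p : Vec T n) (x : Vec Bool n) → (p ⊕ᵛ ⌜ x ⌝ᵛ) ⊕ᵛ ⌜ x ⌝ᵛ ≡ p
⊕ᵛ-involutive [] [] = refl
⊕ᵛ-involutive (t ∷ p) (c ∷ x) = cong₂ _∷_ (⊕-involutive t c) (⊕ᵛ-involutive p x)

⊕⌜⌝≡𝐮⇔ : ∀ t c → t ⊕ ⌜ c ⌝ ≡ 𝐮 ⇔ t ≡ 𝐮
⊕⌜⌝≡𝐮⇔ 𝐮 _     = mk⇔ (λ _ → refl) (λ _ → refl)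
⊕⌜⌝≡𝐮⇔ 𝟎 false = mk⇔ (λ ()) (λ ())
⊕⌜⌝≡𝐮⇔ 𝟎 true  = mk⇔ (λ ()) (λ ())
⊕⌜⌝≡𝐮⇔ 𝟏 false = mk⇔ (λ ()) (λ ())
⊕⌜⌝≡𝐮⇔ 𝟏 true  = mk⇔ (λ ()) (λ ())

Stable-⊕ᵛ : (p : Vec T n) (x : Vec Bool n) (i : Fin n) →
  Stable (lookup (p ⊕ᵛ ⌜ x ⌝ᵛ) i) ⇔ Stable (lookup p i)
Stable-⊕ᵛ (t ∷ p) (c ∷ x) zero    = ¬-cong-⇔ (⊕⌜⌝≡𝐮⇔ t c)
Stable-⊕ᵛ (t ∷ p) (c ∷ x) (suc i) = Stable-⊕ᵛ p x i

⊕ᵛ-[]≔𝐮 : (q v : Vec T n) (i : Fin n) → (q [ i ]≔ 𝐮) ⊕ᵛ v ≡ (q ⊕ᵛ v) [ i ]≔ 𝐮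
⊕ᵛ-[]≔𝐮 (t ∷ q) (s ∷ v) zero    = refl
⊕ᵛ-[]≔𝐮 (t ∷ q) (s ∷ v) (suc i) = cong ((t ⊕ s) ∷_) (⊕ᵛ-[]≔𝐮 q v i)

⊕ᵛ-⪯falses : {p : Vec T n} (x : Vec Bool n) → p ⪯ ⌜ x ⌝ᵛ → (p ⊕ᵛ ⌜ x ⌝ᵛ) ⪯ ⌜ falses ⌝ᵛ
⊕ᵛ-⪯falses [] []⪯ = []⪯
⊕ᵛ-⪯falses (false ∷ x) (refl⪯ ∷⪯ r) = refl⪯ ∷⪯ ⊕ᵛ-⪯falses x r
⊕ᵛ-⪯falses (true ∷ x)  (refl⪯ ∷⪯ r) = refl⪯ ∷⪯ ⊕ᵛ-⪯falses x r
⊕ᵛ-⪯falses (_ ∷ x)     (u⪯ ∷⪯ r)    = u⪯ ∷⪯ ⊕ᵛ-⪯falses x r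

+u-supp≡⊕ᵛ : (x : Vec Bool n) {q : Vec T n} → q ⪯ ⌜ falses ⌝ᵛ → x +u supp q ≡ q ⊕ᵛ ⌜ x ⌝ᵛ
+u-supp≡⊕ᵛ [] []⪯ = refl
+u-supp≡⊕ᵛ (false ∷ x) (refl⪯ ∷⪯ r) = cong (𝟎 ∷_) (+u-supp≡⊕ᵛ x r)
+u-supp≡⊕ᵛ (true ∷ x)  (refl⪯ ∷⪯ r) = cong (𝟏 ∷_) (+u-supp≡⊕ᵛ x r)
+u-supp≡⊕ᵛ (_ ∷ x)     (u⪯ ∷⪯ r)    = cong (𝐮 ∷_) (+u-supp≡⊕ᵛ x r)

⊕ᵛ-⪯ : (x : Vec Bool n) {q : Vec T n} → q ⪯ ⌜ falses ⌝ᵛ → (q ⊕ᵛ ⌜ x ⌝ᵛ) ⪯ ⌜ x ⌝ᵛ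
⊕ᵛ-⪯ x {q} r = subst (_⪯ ⌜ x ⌝ᵛ) (+u-supp≡⊕ᵛ x r) (+u-⪯ x (supp q))

⪯falses : (q : Vec T n) → (∀ i → lookup q i ≢ 𝟏) → q ⪯ ⌜ falses ⌝ᵛ
⪯falses [] _ = []⪯
⪯falses (𝟎 ∷ q) no𝟏 = refl⪯ ∷⪯ ⪯falses q (no𝟏 ∘ suc)
⪯falses (𝐮 ∷ q) no𝟏 = u⪯ ∷⪯ ⪯falses q (no𝟏 ∘ suc)
⪯falses (𝟏 ∷ q) no𝟏 = ⊥-elim (no𝟏 zero refl)

Prime-cong : ∀ {h h′ : Vec Bool n → Bool} {b b′ p p′} →
  (tilde h p ≡ ⌜ b ⌝ ⇔ tilde h′ p′ ≡ ⌜ b′ ⌝) →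
  (∀ i → Stable (lookup p i) ⇔ Stable (lookup p′ i)) →
  (∀ i → tilde h (p [ i ]≔ 𝐮) ≡ 𝐮 ⇔ tilde h′ (p′ [ i ]≔ 𝐮) ≡ 𝐮) →
  Prime h b p ⇔ Prime h′ b′ p′
Prime-cong value stable minimal = mk⇔
  (λ (v , m) → to value v , λ i s → to (minimal i) (m i (from (stable i) s)))
  (λ (v , m) → from value v , λ i s → from (minimal i) (m i (to (stable i) s)))

module _ (f : Vec Bool n → Bool) (x : Vec Bool n) where

  ∂≡false⇔Const : ∀ y → ∂ f x y ≡ false ⇔ Const f (x +u y) (f x)
  ∂≡false⇔Const y = ⇔-trans (not-=ₜ⌜⌝≡false⇔ _ (f x)) (tilde≡⌜⌝⇔Const f (x +u y) (f x))

  Const-∂⇔ : ∀ q → Const (∂ f x) q false ⇔ Const f (x +u supp q) (f x)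
  Const-∂⇔ q = mk⇔
    (λ k → to (∂≡false⇔Const (supp q)) (k (supp q) (⪯-supp q)))
    (λ k y r → from (∂≡false⇔Const y) (Const-anti (+u-supp-⪯ x y q r) k))

  ∂-falses : ∂ f x falses ≡ false
  ∂-falses = from (∂≡false⇔Const falses) (subst (λ v → Const f v (f x)) (sym (+u-falses x)) (Const-⌜⌝ᵛ f x))

  tilde-∂≡𝟎⇔ : ∀ q → tilde (∂ f x) q ≡ 𝟎 ⇔ tilde f (x +u supp q) ≡ ⌜ f x ⌝
  tilde-∂≡𝟎⇔ q = ⇔-trans (tilde≡⌜⌝⇔Const (∂ f x) q false)
                  (⇔-trans (Const-∂⇔ q) (⇔-sym (tilde≡⌜⌝⇔Const f _ (f x))))

  tilde-∂≡𝐮⇔ : ∀ {q} → q ⪯ ⌜ falses ⌝ᵛ → tilde (∂ f x) q ≡ 𝐮 ⇔ tilde f (x +u supp q) ≡ 𝐮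
  tilde-∂≡𝐮⇔ {q} r = ⇔-trans (tilde≡𝐮⇔¬Const r ∂-falses)
                      (⇔-trans (¬-cong-⇔ (Const-∂⇔ q)) (⇔-sym (tilde≡𝐮⇔¬Const (+u-⪯ x (supp q)) refl)))

  prime-implicate-∂-⪯falses : ∀ {q} → Prime (∂ f x) false q → q ⪯ ⌜ falses ⌝ᵛ
  prime-implicate-∂-⪯falses {q} (value , minimal) = ⪯falses q no𝟏
    where
    no𝟏 : ∀ i → lookup q i ≢ 𝟏
    no𝟏 i qᵢ≡𝟏 = ⌜⌝≢𝐮 false (trans (sym still-𝟎) (minimal i stable))
      where
      stable : Stable (lookup q i)
      stable qᵢ≡𝐮 = ⌜⌝≢𝐮 true (trans (sym qᵢ≡𝟏) qᵢ≡𝐮)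
      still-𝟎 : tilde (∂ f x) (q [ i ]≔ 𝐮) ≡ 𝟎
      still-𝟎 = from (tilde-∂≡𝟎⇔ _)
        (subst (λ s → tilde f (x +u s) ≡ ⌜ f x ⌝) (sym (supp-[]≔𝐮 q i qᵢ≡𝟏)) (to (tilde-∂≡𝟎⇔ q) value))

  Prime-∂⇔ : ∀ {q} → q ⪯ ⌜ falses ⌝ᵛ → Prime (∂ f x) false q ⇔ Prime f (f x) (q ⊕ᵛ ⌜ x ⌝ᵛ)
  Prime-∂⇔ {q} r =
    Prime-cong {h = ∂ f x} {f} {p = q} {q ⊕ᵛ ⌜ x ⌝ᵛ} value (λ i → ⇔-sym (Stable-⊕ᵛ q x i)) minimal
    where
    value : tilde (∂ f x) q ≡ 𝟎 ⇔ tilde f (q ⊕ᵛ ⌜ x ⌝ᵛ) ≡ ⌜ f x ⌝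
    value rewrite sym (+u-supp≡⊕ᵛ x r) = tilde-∂≡𝟎⇔ q
    minimal : ∀ i → tilde (∂ f x) (q [ i ]≔ 𝐮) ≡ 𝐮 ⇔ tilde f ((q ⊕ᵛ ⌜ x ⌝ᵛ) [ i ]≔ 𝐮) ≡ 𝐮
    minimal i rewrite sym (⊕ᵛ-[]≔𝐮 q ⌜ x ⌝ᵛ i) | sym (+u-supp≡⊕ᵛ x ([]≔𝐮-⪯ i r)) =
      tilde-∂≡𝐮⇔ ([]≔𝐮-⪯ i r)

lemma3p4 : (n : ℕ) (f : Vec Bool n → Bool) → NonConstant f →
    (x : Vec Bool n) (b : Bool) → f x ≡ b →
    (q : Vec T n) →
      Prime (∂ f x) false q ⇔ (∃[ p ] (Prime f b p × p ⪯ ⌜ x ⌝ᵛ × q ≡ p ⊕ᵛ ⌜ x ⌝ᵛ))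
lemma3p4 _ f _ x .(f x) refl q = mk⇔ forward backward
  where
  forward : Prime (∂ f x) false q → ∃[ p ] (Prime f (f x) p × p ⪯ ⌜ x ⌝ᵛ × q ≡ p ⊕ᵛ ⌜ x ⌝ᵛ)
  forward prime =
    q ⊕ᵛ ⌜ x ⌝ᵛ , to (Prime-∂⇔ f x q⪯falses) prime , ⊕ᵛ-⪯ x q⪯falses , sym (⊕ᵛ-involutive q x)
    where
    q⪯falses : q ⪯ ⌜ falses ⌝ᵛ
    q⪯falses = prime-implicate-∂-⪯falses f x prime
  backward : ∃[ p ] (Prime f (f x) p × p ⪯ ⌜ x ⌝ᵛ × q ≡ p ⊕ᵛ ⌜ x ⌝ᵛ) → Prime (∂ f x) false q
  backward (p , prime , p⪯x , q≡p⊕x) = subst (Prime (∂ f x) false) (sym q≡p⊕x)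
    (from (Prime-∂⇔ f x (⊕ᵛ-⪯falses x p⪯x)) (subst (Prime f (f x)) (sym (⊕ᵛ-involutive p x)) prime))
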